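{- Let $G$ be a connected graph of order $n\ge 2$ and let $H$ be a graph with $l\ge 1$ connected components $H_1,\dots,H_l$, where $|V(H_i)|=m_i\ge 2$ for each $i$. Then $$Z(G\circ H)\ge (n-1)l+\sum_{i=1}^{l}m_i.$$
   Context: Graphs are finite, simple, undirected. Zero forcing: given a set $S$ of initially black vertices (others white), the color-change rule turns a white vertex black if it is the only white neighbor of some black vertex; $S$ is a zero forcing set if eventually all vertices become black; $Z(G)$ is the minimum size of a zero forcing set. The lexicographic product $G\circ H$ has vertex set $V(G)\times V(H)$, with $(a,v)$ adjacent to $(b,w)$ iff $ab\in E(G)$, or $a=b$ and $vw\in E(H)$. -}

module Defs where

open import Data.Nat using (ℕ; zero; suc; _+_; _*_; _∸_; _≤_)
open import Data.Bool using (Bool; true; false; _∨_; _∧_)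
open import Data.Fin using (Fin; remQuot)
open import Data.Fin.Properties using (_≟_)
open import Data.Fin.Subset using (Subset; _∈_; _∉_; _∪_; ⁅_⁆; ⊤; ∣_∣)
open import Data.Vec using (tabulate)
open import Data.Product using (Σ; ∃; _×_; _,_; proj₁; proj₂)
open import Data.List using (map; allFin)
open import Data.Nat.ListAction using (sum)
open import Relation.Nullary using (¬_)
open import Relation.Nullary.Decidable using (⌊_⌋)
open import Relation.Binary.PropositionalEquality using (_≡_; _≢_)
open import Relation.Binary.Construct.Closure.ReflexiveTransitive using (Star)

Adj : ℕ → Set
Adj N = Fin N → Fin N → Bool

record Graph (N : ℕ) : Set where
  field
    adj     : Adj N
    symm    : ∀ u v → adj u v ≡ adj v u
    irrefl  : ∀ u → adj u u ≡ false

open Graph public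

Edge : ∀ {N} → Graph N → Fin N → Fin N → Set
Edge G u v = adj G u v ≡ true

Reachable : ∀ {N} → Graph N → Fin N → Fin N → Set
Reachable G = Star (Edge G)

Connected : ∀ {N} → Graph N → Set
Connected G = ∀ u v → Reachable G u v

record Components {N : ℕ} (H : Graph N) (l : ℕ) : Set where
  field
    label      : Fin N → Fin l
    surjective : ∀ i → ∃ λ v → label v ≡ i
    sound      : ∀ u v → label u ≡ label v → Reachable H u v
    complete   : ∀ u v → Reachable H u v → label u ≡ label v

open Components public

componentSet : ∀ {N l} {H : Graph N} → Components H l → Fin l → Subset N
componentSet C i = tabulate (λ v → ⌊ label C v ≟ i ⌋)

componentOrder : ∀ {N l} {H : Graph N} → Components H l → Fin l → ℕ
componentOrder C i = ∣ componentSet C i ∣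

Force : ∀ {N} → Adj N → Subset N → Subset N → Set
Force {N} A B B′ =
  Σ (Fin N) λ u → Σ (Fin N) λ w →
    u ∈ B × w ∉ B × A u w ≡ true ×
    (∀ v → A u v ≡ true → v ≢ w → v ∈ B) ×
    B′ ≡ B ∪ ⁅ w ⁆

IsZeroForcingSet : ∀ {N} → Adj N → Subset N → Set
IsZeroForcingSet A S = Star (Force A) S ⊤

-- Lexicographic product G ∘ H on Fin (n * k); vertex x ↔ remQuot k x = (a , v).
lexAdj : ∀ {n k} → Graph n → Graph k → Adj (n * k)
lexAdj {n} {k} G H x y with remQuot {n} k x | remQuot {n} k y
... | a , v | b , w = adj G a b ∨ (⌊ a ≟ b ⌋ ∧ adj H v w)

-- Every zero forcing set S of G ∘ H meets every component layer {a} × V(H_i).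
-- Going backwards along the forcing chain: if (a, v) is forced by u, then either
-- u lies in the component layer of (a, v) itself, or u is adjacent to the whole
-- layer {a} × V(H), hence to (a, z) for some z ≠ v in the same component, which
-- was therefore already black. So each of the n layers contains l vertices of S.
-- The first force yields two layers containing k + l vertices of S together: if
-- u = (a, v) forces inside its own layer, the layer of a G-neighbour of a is
-- adjacent to u and hence entirely black; otherwise u forces some (b, x) with
-- b ≠ a, so layer b is black except for (b, x), and so is (a, y) for an
-- H-neighbour y of v, giving the component layer of v two vertices of S.
module Submission where

open import Defs
open import Data.Nat using (ℕ; _+_; _*_; _∸_; _≤_)
open import Data.Fin using (Fin)
open import Data.Fin.Subset using (Subset; ∣_∣)
open import Data.List using (map; allFin)
open import Data.Nat.ListAction using (sum)

open import Function using (_∘_)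
open import Data.Nat using (zero; suc; _<_; z≤n; s≤s)
open import Data.Nat.Properties
  using (+-0-commutativeMonoid; ≤-trans; ≤-reflexive; +-mono-≤; +-monoʳ-≤;
         +-monoˡ-≤; m≤m+n; m≤n+m; m≤n+m∸n; +-assoc; +-comm; +-suc; +-identityʳ;
         *-identityˡ; *-identityʳ; module ≤-Reasoning)
open import Data.Fin using (zero; suc; combine; punchIn; punchOut; _↑ˡ_; _↑ʳ_)
open import Data.Fin.Properties
  using (_≟_; remQuot-combine; combine-remQuot; combine-injectiveˡ; combine-injectiveʳ;
         punchInᵢ≢i; punchIn-injective; punchIn-punchOut; any?)
open import Data.Fin.Subset using (_∈_; ⁅_⁆; ⊤; _⊆_)
open import Data.Fin.Subset.Properties using (x∈p∪q⁻; x∈⁅x⁆; x∈⁅y⁆⇒x≡y; ∣⁅x⁆∣≡1; p⊆q⇒∣p∣≤∣q∣; ∈⊤)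
open import Data.Bool using (Bool; true; false; _∨_; _∧_)
open import Data.Bool.Properties using (∨-identityʳ)
open import Data.Vec using ([]; _∷_; lookup; tabulate)
open import Data.Vec.Properties using ([]=⇒lookup; lookup∘tabulate)
open import Data.Vec.Functional using (removeAt)
import Data.List as List
open import Data.List.Properties using (map-tabulate)
open import Data.Product using (∃; ∃₂; _×_; _,_)
open import Data.Sum using (inj₁; inj₂)
open import Relation.Nullary using (¬_; Dec; yes; no; contradiction)
open import Relation.Nullary.Decidable using (⌊_⌋; ¬?; _×-dec_; isYes≗does; dec-true; dec-false)
open import Relation.Binary.PropositionalEquality
  using (_≡_; _≢_; refl; sym; trans; cong; cong₂; subst; module ≡-Reasoning)
open import Relation.Binary.Construct.Closure.ReflexiveTransitive using (ε; _◅_)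
open import Algebra.Properties.CommutativeMonoid.Sum +-0-commutativeMonoid
  using (sum-syntax; sum-remove; ∑-comm; sum-cong-≗) renaming (sum to ∑)

⌊⌋-true : ∀ {A : Set} (a? : Dec A) → A → ⌊ a? ⌋ ≡ true
⌊⌋-true a? a = trans (isYes≗does a?) (dec-true a? a)

⌊⌋-false : ∀ {A : Set} (a? : Dec A) → ¬ A → ⌊ a? ⌋ ≡ false
⌊⌋-false a? ¬a = trans (isYes≗does a?) (dec-false a? ¬a)

indicator : Bool → ℕ
indicator true  = 1
indicator false = 0

∑-mono-≤ : ∀ {N} {f g : Fin N → ℕ} → (∀ i → f i ≤ g i) → ∑ f ≤ ∑ g
∑-mono-≤ {zero}  f≤g = z≤n
∑-mono-≤ {suc N} f≤g = +-mono-≤ (f≤g zero) (∑-mono-≤ (f≤g ∘ suc))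

∑-mono-< : ∀ {N} {f g : Fin N → ℕ} x → (∀ i → f i ≤ g i) → f x < g x → ∑ f < ∑ g
∑-mono-< {suc N} {f} {g} x f≤g fx<gx = begin-strict
  ∑ f                       ≡⟨ sum-remove f ⟩
  f x + ∑ (removeAt f x)    <⟨ +-mono-≤ fx<gx (∑-mono-≤ (f≤g ∘ punchIn x)) ⟩
  g x + ∑ (removeAt g x)    ≡⟨ sum-remove g ⟨
  ∑ g                       ∎
  where open ≤-Reasoning

∑-const : ∀ N c → ∑[ i < N ] c ≡ N * c
∑-const zero    c = refl
∑-const (suc N) c = cong (c +_) (∑-const N c)

∑-1 : ∀ N → ∑[ i < N ] 1 ≡ N
∑-1 N = trans (∑-const N 1) (*-identityʳ N)

∑-zero : ∀ {N} {f : Fin N → ℕ} → (∀ i → f i ≡ 0) → ∑ f ≡ 0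
∑-zero {zero}  f≡0 = refl
∑-zero {suc N} f≡0 = cong₂ _+_ (f≡0 zero) (∑-zero (f≡0 ∘ suc))

∑-≥-point : ∀ {N} (f : Fin N → ℕ) x → f x ≤ ∑ f
∑-≥-point {suc N} f x = ≤-trans (m≤m+n (f x) _) (≤-reflexive (sym (sum-remove f)))

∑-≥-allBut : ∀ {N} (f : Fin N → ℕ) {x c} →
  (∀ z → z ≢ x → c ≤ f z) → f x + (N ∸ 1) * c ≤ ∑ f
∑-≥-allBut {suc N} f {x} {c} c≤f = begin
  f x + N * c               ≡⟨ cong (f x +_) (∑-const N c) ⟨
  f x + ∑[ j < N ] c        ≤⟨ +-monoʳ-≤ (f x) (∑-mono-≤ λ j → c≤f (punchIn x j) (punchInᵢ≢i x j)) ⟩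
  f x + ∑ (removeAt f x)    ≡⟨ sum-remove f ⟨
  ∑ f                       ∎
  where open ≤-Reasoning

∑-≥-allBut₂ : ∀ {N} (f : Fin N → ℕ) {x y c} → x ≢ y →
  (∀ z → z ≢ x → z ≢ y → c ≤ f z) → f x + f y + (N ∸ 2) * c ≤ ∑ f
∑-≥-allBut₂ {suc N} f {x} {y} {c} x≢y c≤f = begin
  f x + f y + (N ∸ 1) * c                 ≡⟨ +-assoc (f x) (f y) _ ⟩
  f x + (f y + (N ∸ 1) * c)               ≡⟨ cong (λ z → f x + (f z + (N ∸ 1) * c)) (punchIn-punchOut x≢y) ⟨
  f x + (f (punchIn x y′) + (N ∸ 1) * c)  ≤⟨ +-monoʳ-≤ (f x) (∑-≥-allBut (removeAt f x) c≤rest) ⟩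
  f x + ∑ (removeAt f x)                  ≡⟨ sum-remove f ⟨
  ∑ f                                     ∎
  where
  open ≤-Reasoning
  y′ = punchOut x≢y
  c≤rest : ∀ z → z ≢ y′ → c ≤ f (punchIn x z)
  c≤rest z z≢y′ = c≤f (punchIn x z) (punchInᵢ≢i x z)
    (λ eq → z≢y′ (punchIn-injective x z y′ (trans eq (sym (punchIn-punchOut x≢y)))))

∑-↑ : ∀ m n (f : Fin (m + n) → ℕ) →
  ∑ f ≡ ∑[ i < m ] f (i ↑ˡ n) + ∑[ j < n ] f (m ↑ʳ j)
∑-↑ zero    n f = refl
∑-↑ (suc m) n f = trans (cong (f zero +_) (∑-↑ m n (f ∘ suc))) (sym (+-assoc (f zero) _ _))

∑-combine : ∀ n k (f : Fin (n * k) → ℕ) → ∑ f ≡ ∑[ a < n ] ∑[ v < k ] f (combine a v)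
∑-combine zero    k f = refl
∑-combine (suc n) k f =
  trans (∑-↑ k (n * k) f) (cong (∑[ v < k ] f (v ↑ˡ (n * k)) +_) (∑-combine n k (f ∘ (k ↑ʳ_))))

∑-indicator-≟ : ∀ {N} (j : Fin N) c → ∑[ i < N ] (indicator ⌊ j ≟ i ⌋ * c) ≡ c
∑-indicator-≟ {suc N} j c = begin
  ∑[ i < suc N ] (indicator ⌊ j ≟ i ⌋ * c)                      ≡⟨ sum-remove (λ i → indicator ⌊ j ≟ i ⌋ * c) ⟩
  indicator ⌊ j ≟ j ⌋ * c + ∑[ i < N ] (indicator ⌊ j ≟ punchIn j i ⌋ * c)
      ≡⟨ cong₂ (λ b r → indicator b * c + r) (⌊⌋-true (j ≟ j) refl) (∑-zero off-diagonal) ⟩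
  1 * c + 0                                                     ≡⟨ +-identityʳ (1 * c) ⟩
  1 * c                                                         ≡⟨ *-identityˡ c ⟩
  c                                                             ∎
  where
  open ≡-Reasoning
  off-diagonal : ∀ i → indicator ⌊ j ≟ punchIn j i ⌋ * c ≡ 0
  off-diagonal i = cong (λ b → indicator b * c) (⌊⌋-false (j ≟ punchIn j i) (punchInᵢ≢i j i ∘ sym))

∑-partition : ∀ {k l} (g : Fin k → Fin l) (h : Fin k → ℕ) →
  ∑ h ≡ ∑[ i < l ] ∑[ v < k ] (indicator ⌊ g v ≟ i ⌋ * h v)
∑-partition g h = sym (trans (∑-comm (λ i v → indicator ⌊ g v ≟ i ⌋ * h v))
                              (sum-cong-≗ λ v → ∑-indicator-≟ (g v) (h v)))

sum-tabulate : ∀ {l} (f : Fin l → ℕ) → sum (List.tabulate f) ≡ ∑ f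
sum-tabulate {zero}  f = refl
sum-tabulate {suc l} f = cong (f zero +_) (sum-tabulate (f ∘ suc))

sum-map-allFin : ∀ {l} (f : Fin l → ℕ) → sum (map f (allFin l)) ≡ ∑ f
sum-map-allFin f = trans (cong sum (map-tabulate (λ i → i) f)) (sum-tabulate f)

∣p∣≡∑indicator : ∀ {N} (p : Subset N) → ∣ p ∣ ≡ ∑[ x < N ] indicator (lookup p x)
∣p∣≡∑indicator []          = refl
∣p∣≡∑indicator (true ∷ p)  = cong suc (∣p∣≡∑indicator p)
∣p∣≡∑indicator (false ∷ p) = ∣p∣≡∑indicator p

∈⇒indicator≡1 : ∀ {N} {p : Subset N} {x} → x ∈ p → indicator (lookup p x) ≡ 1
∈⇒indicator≡1 x∈p = cong indicator ([]=⇒lookup x∈p)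

Edge⇒≢ : ∀ {N} (G : Graph N) {u v} → Edge G u v → u ≢ v
Edge⇒≢ G {u} uv refl with trans (sym (irrefl G u)) uv
... | ()

Reachable⇒neighbour : ∀ {N} {G : Graph N} {u v} → Reachable G u v → u ≢ v → ∃ (Edge G u)
Reachable⇒neighbour ε                u≢u = contradiction refl u≢u
Reachable⇒neighbour (_◅_ {j = w} uw _) _ = w , uw

connected⇒neighbour : ∀ {N} {G : Graph N} → 2 ≤ N → Connected G → ∀ u → ∃ (Edge G u)
connected⇒neighbour {G = G} (s≤s (s≤s _)) conn u =
  Reachable⇒neighbour {G = G} (conn u (punchIn u zero)) (punchInᵢ≢i u zero ∘ sym)

2≤⇒distinctPair : ∀ {N} → 2 ≤ N → ∃₂ λ (b c : Fin N) → b ≢ c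
2≤⇒distinctPair (s≤s (s≤s _)) = zero , suc zero , λ ()

[n∸1]*l+k≡k+l+[n∸2]*l : ∀ {n} l k → 2 ≤ n → (n ∸ 1) * l + k ≡ k + l + (n ∸ 2) * l
[n∸1]*l+k≡k+l+[n∸2]*l l k (s≤s (s≤s {n = m} _)) = trans (+-comm (l + m * l) k) (sym (+-assoc k l (m * l)))

module _ {k l} {H : Graph k} (C : Components H l) where

  ∈componentSet⇒label : ∀ {v i} → v ∈ componentSet C i → label C v ≡ i
  ∈componentSet⇒label {v} {i} v∈
    with label C v ≟ i | trans (sym (lookup∘tabulate (λ z → ⌊ label C z ≟ i ⌋) v)) ([]=⇒lookup v∈)
  ... | yes eq | _  = eq
  ... | no _   | ()

  nontrivial⇒sameComponent : ∀ {v} → 2 ≤ componentOrder C (label C v) →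
    ∃ λ z → z ≢ v × label C z ≡ label C v
  nontrivial⇒sameComponent {v} 2≤order with any? (λ z → ¬? (z ≟ v) ×-dec (label C z ≟ label C v))
  ... | yes found = found
  ... | no none =
    contradiction (≤-trans 2≤order (≤-trans (p⊆q⇒∣p∣≤∣q∣ component⊆⁅v⁆) (≤-reflexive (∣⁅x⁆∣≡1 v)))) λ { (s≤s ()) }
    where
    component⊆⁅v⁆ : componentSet C (label C v) ⊆ ⁅ v ⁆
    component⊆⁅v⁆ {z} z∈ with z ≟ v
    ... | yes refl = x∈⁅x⁆ v
    ... | no z≢v   = contradiction (z , z≢v , ∈componentSet⇒label z∈) none

  nontrivial⇒neighbour : ∀ {v} → 2 ≤ componentOrder C (label C v) → ∃ (Edge H v)
  nontrivial⇒neighbour 2≤order with nontrivial⇒sameComponent 2≤order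
  ... | z , z≢v , same = Reachable⇒neighbour {G = H} (sound C _ z (sym same)) (z≢v ∘ sym)

  componentOrder≡∑ : ∀ i → componentOrder C i ≡ ∑[ v < k ] indicator ⌊ label C v ≟ i ⌋
  componentOrder≡∑ i = trans (∣p∣≡∑indicator (componentSet C i))
    (sum-cong-≗ λ v → cong indicator (lookup∘tabulate (λ z → ⌊ label C z ≟ i ⌋) v))

  ∑componentOrder≡order : sum (map (componentOrder C) (allFin l)) ≡ k
  ∑componentOrder≡order = begin
    sum (map (componentOrder C) (allFin l))                  ≡⟨ sum-map-allFin (componentOrder C) ⟩
    ∑ (componentOrder C)                                     ≡⟨ sum-cong-≗ (λ i → trans (componentOrder≡∑ i)
                                                                  (sum-cong-≗ λ v → sym (*-identityʳ (indicator ⌊ label C v ≟ i ⌋)))) ⟩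
    ∑[ i < l ] ∑[ v < k ] (indicator ⌊ label C v ≟ i ⌋ * 1)  ≡⟨ ∑-partition (label C) (λ _ → 1) ⟨
    ∑[ v < k ] 1                                             ≡⟨ ∑-const k 1 ⟩
    k * 1                                                    ≡⟨ *-identityʳ k ⟩
    k                                                        ∎
    where open ≡-Reasoning

module LexicographicProduct {n k} (G : Graph n) (H : Graph k) where

  _~_ : Fin (n * k) → Fin (n * k) → Set
  x ~ y = lexAdj G H x y ≡ true

  data Layered : Fin (n * k) → Set where
    ⟨_,_⟩ : (a : Fin n) (v : Fin k) → Layered (combine a v)

  layered : ∀ x → Layered x
  layered x = subst Layered (combine-remQuot {n} k x) ⟨ _ , _ ⟩

  lexAdj-combine : ∀ a v b w →
    lexAdj G H (combine a v) (combine b w) ≡ (adj G a b ∨ (⌊ a ≟ b ⌋ ∧ adj H v w))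
  lexAdj-combine a v b w = cong₂ layerAdj (remQuot-combine a v) (remQuot-combine b w)
    where
    layerAdj : Fin n × Fin k → Fin n × Fin k → Bool
    layerAdj (a , v) (b , w) = adj G a b ∨ (⌊ a ≟ b ⌋ ∧ adj H v w)

  lexAdj-sameLayer : ∀ a v w → lexAdj G H (combine a v) (combine a w) ≡ adj H v w
  lexAdj-sameLayer a v w rewrite lexAdj-combine a v a w | irrefl G a | ⌊⌋-true (a ≟ a) refl = refl

  lexAdj-otherLayer : ∀ {a b : Fin n} (v w : Fin k) → a ≢ b → lexAdj G H (combine a v) (combine b w) ≡ adj G a b
  lexAdj-otherLayer {a} {b} v w a≢b
    rewrite lexAdj-combine a v b w | ⌊⌋-false (a ≟ b) a≢b = ∨-identityʳ (adj G a b)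

  otherLayer-~ : ∀ {a b : Fin n} {v w : Fin k} z → a ≢ b → combine a v ~ combine b w → combine a v ~ combine b z
  otherLayer-~ {v = v} {w} z a≢b uw =
    trans (lexAdj-otherLayer v z a≢b) (trans (sym (lexAdj-otherLayer v w a≢b)) uw)

  ≢-layer : ∀ {a b : Fin n} (v w : Fin k) → a ≢ b → combine a v ≢ combine b w
  ≢-layer v w a≢b = a≢b ∘ combine-injectiveˡ _ v _ w

module ZeroForcing {n k l} (G : Graph n) (H : Graph k) (C : Components H l)
                   (nontrivial : ∀ i → 2 ≤ componentOrder C i) where

  open LexicographicProduct G H

  layerCount : Subset (n * k) → Fin n → ℕ
  layerCount S a = ∑[ v < k ] indicator (lookup S (combine a v))

  componentLayerCount : Subset (n * k) → Fin n → Fin l → ℕ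
  componentLayerCount S a i = ∑[ v < k ] (indicator ⌊ label C v ≟ i ⌋ * indicator (lookup S (combine a v)))

  MeetsEveryComponentLayer : Subset (n * k) → Set
  MeetsEveryComponentLayer B = ∀ (a : Fin n) i → ∃ λ v → label C v ≡ i × combine a v ∈ B

  ∣S∣≡∑layerCount : ∀ S → ∣ S ∣ ≡ ∑ (layerCount S)
  ∣S∣≡∑layerCount S = trans (∣p∣≡∑indicator S) (∑-combine n k _)

  layerCount≡∑componentLayerCount : ∀ S a → layerCount S a ≡ ∑ (componentLayerCount S a)
  layerCount≡∑componentLayerCount S a = ∑-partition (label C) _

  componentLayerTerm≡1 : ∀ {S} {a : Fin n} {i v} → label C v ≡ i → combine a v ∈ S →
    indicator ⌊ label C v ≟ i ⌋ * indicator (lookup S (combine a v)) ≡ 1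
  componentLayerTerm≡1 {i = i} {v} refl v∈S =
    cong₂ (λ b c → indicator b * c) (⌊⌋-true (label C v ≟ i) refl) (∈⇒indicator≡1 v∈S)

  meets⇒1≤componentLayerCount : ∀ {S} → MeetsEveryComponentLayer S → ∀ a i → 1 ≤ componentLayerCount S a i
  meets⇒1≤componentLayerCount meets a i with meets a i
  ... | v , lv , v∈S = ≤-trans (≤-reflexive (sym (componentLayerTerm≡1 lv v∈S))) (∑-≥-point _ v)

  meets⇒l≤layerCount : ∀ {S} → MeetsEveryComponentLayer S → ∀ a → l ≤ layerCount S a
  meets⇒l≤layerCount {S} meets a = begin
    l                              ≡⟨ ∑-1 l ⟨
    ∑[ i < l ] 1                   ≤⟨ ∑-mono-≤ (meets⇒1≤componentLayerCount meets a) ⟩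
    ∑ (componentLayerCount S a)    ≡⟨ layerCount≡∑componentLayerCount S a ⟨
    layerCount S a                 ∎
    where open ≤-Reasoning

  twoInComponent⇒l<layerCount : ∀ {S} {a : Fin n} {v y} → MeetsEveryComponentLayer S →
    y ≢ v → label C y ≡ label C v → combine a v ∈ S → combine a y ∈ S → l < layerCount S a
  twoInComponent⇒l<layerCount {S} {a} {v} {y} meets y≢v same v∈S y∈S = begin-strict
    l                              ≡⟨ ∑-1 l ⟨
    ∑[ i < l ] 1                   <⟨ ∑-mono-< (label C v) (meets⇒1≤componentLayerCount meets a) two≤ ⟩
    ∑ (componentLayerCount S a)    ≡⟨ layerCount≡∑componentLayerCount S a ⟨
    layerCount S a                 ∎
    where
    open ≤-Reasoning
    two≤ : 2 ≤ componentLayerCount S a (label C v)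
    two≤ = begin
      2                                ≤⟨ m≤m+n 2 _ ⟩
      1 + 1 + (k ∸ 2) * 0              ≡⟨ cong₂ (λ p q → p + q + (k ∸ 2) * 0)
                                            (componentLayerTerm≡1 refl v∈S) (componentLayerTerm≡1 same y∈S) ⟨
      _                                ≤⟨ ∑-≥-allBut₂ _ (y≢v ∘ sym) (λ _ _ _ → z≤n) ⟩
      componentLayerCount S a (label C v) ∎

  fullLayer⇒k≤layerCount : ∀ {S} {a : Fin n} → (∀ v → combine a v ∈ S) → k ≤ layerCount S a
  fullLayer⇒k≤layerCount {S} {a} full = begin
    k                 ≡⟨ ∑-1 k ⟨
    ∑[ v < k ] 1      ≡⟨ sum-cong-≗ (λ v → ∈⇒indicator≡1 (full v)) ⟨
    layerCount S a    ∎
    where open ≤-Reasoning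

  allButOne⇒k≤suc-layerCount : ∀ {S} {a : Fin n} {x} → (∀ v → v ≢ x → combine a v ∈ S) →
    k ≤ suc (layerCount S a)
  allButOne⇒k≤suc-layerCount {S} {a} {x} rest = begin
    k                                                        ≤⟨ m≤n+m∸n k 1 ⟩
    suc (k ∸ 1)                                              ≡⟨ cong suc (*-identityʳ (k ∸ 1)) ⟨
    suc ((k ∸ 1) * 1)                                        ≤⟨ s≤s (m≤n+m _ _) ⟩
    suc (indicator (lookup S (combine a x)) + (k ∸ 1) * 1)   ≤⟨ s≤s (∑-≥-allBut _ λ v v≢x →
                                                                   ≤-reflexive (sym (∈⇒indicator≡1 (rest v v≢x)))) ⟩
    suc (layerCount S a)                                     ∎
    where open ≤-Reasoning

  forced⇒componentLayerMet : ∀ {B u} {a : Fin n} {v} → u ∈ B → u ~ combine a v →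
    (∀ y → u ~ y → y ≢ combine a v → y ∈ B) →
    ∃ λ z → label C z ≡ label C v × combine a z ∈ B
  forced⇒componentLayerMet {u = u} {a} {v} u∈B uw others with layered u
  ... | ⟨ a′ , v′ ⟩ with a′ ≟ a
  ...   | yes refl = v′ , complete C v′ v (trans (sym (lexAdj-sameLayer a v′ v)) uw ◅ ε) , u∈B
  ...   | no a′≢a with nontrivial⇒sameComponent C (nontrivial (label C v))
  ...     | z , z≢v , same =
    z , same , others (combine a z) (otherLayer-~ z a′≢a uw) (z≢v ∘ combine-injectiveʳ a z a v)

  force-reflects-meets : ∀ {B B′} → Force (lexAdj G H) B B′ →
    MeetsEveryComponentLayer B′ → MeetsEveryComponentLayer B
  force-reflects-meets {B} (u , w , u∈B , _ , uw , others , refl) meets′ a i with meets′ a i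
  ... | v , lv , v∈B′ with x∈p∪q⁻ B ⁅ w ⁆ v∈B′
  ...   | inj₁ v∈B = v , lv , v∈B
  ...   | inj₂ v∈⁅w⁆ with x∈⁅y⁆⇒x≡y w v∈⁅w⁆
  ...     | refl with forced⇒componentLayerMet u∈B uw others
  ...       | z , same , z∈B = z , trans same lv , z∈B

  zeroForcingSet⇒meets : ∀ {S} → IsZeroForcingSet (lexAdj G H) S → MeetsEveryComponentLayer S
  zeroForcingSet⇒meets ε a i with surjective C i
  ... | v , lv = v , lv , ∈⊤
  zeroForcingSet⇒meets (force ◅ forces) = force-reflects-meets force (zeroForcingSet⇒meets forces)

  heavyLayerPair : ∀ {S} → 2 ≤ n → Connected G → IsZeroForcingSet (lexAdj G H) S →
    ∃₂ λ b c → b ≢ c × k + l ≤ layerCount S b + layerCount S c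
  heavyLayerPair n≥2 _ ε with 2≤⇒distinctPair n≥2
  ... | b , c , b≢c =
    b , c , b≢c , +-mono-≤ (fullLayer⇒k≤layerCount λ _ → ∈⊤) (meets⇒l≤layerCount (zeroForcingSet⇒meets ε) c)
  heavyLayerPair {S} n≥2 conn zf@((u , w , u∈S , _ , uw , others , _) ◅ _) with layered u | layered w
  ... | ⟨ a , v ⟩ | ⟨ b , x ⟩ with a ≟ b
  ...   | yes refl with connected⇒neighbour {G = G} n≥2 conn a
  ...     | c , ac = a , c , Edge⇒≢ G ac , heavy
    where
    open ≤-Reasoning
    full : ∀ y → combine c y ∈ S
    full y = others (combine c y) (trans (lexAdj-otherLayer v y (Edge⇒≢ G ac)) ac)
                    (≢-layer y x (Edge⇒≢ G ac ∘ sym))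
    heavy : k + l ≤ layerCount S a + layerCount S c
    heavy = begin
      k + l                              ≤⟨ +-mono-≤ (fullLayer⇒k≤layerCount full)
                                              (meets⇒l≤layerCount (zeroForcingSet⇒meets zf) a) ⟩
      layerCount S c + layerCount S a    ≡⟨ +-comm (layerCount S c) _ ⟩
      layerCount S a + layerCount S c    ∎
  heavyLayerPair {S} n≥2 conn zf@((u , w , u∈S , _ , uw , others , _) ◅ _)
      | ⟨ a , v ⟩ | ⟨ b , x ⟩ | no a≢b with nontrivial⇒neighbour C (nontrivial (label C v))
  ...     | y , vy = b , a , a≢b ∘ sym , heavy
    where
    open ≤-Reasoning
    y∈S : combine a y ∈ S
    y∈S = others (combine a y) (trans (lexAdj-sameLayer a v y) vy) (≢-layer y x a≢b)
    rest∈S : ∀ z → z ≢ x → combine b z ∈ S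
    rest∈S z z≢x = others (combine b z) (otherLayer-~ z a≢b uw) (z≢x ∘ combine-injectiveʳ b z b x)
    heavy : k + l ≤ layerCount S b + layerCount S a
    heavy = begin
      k + l                              ≤⟨ +-monoˡ-≤ l (allButOne⇒k≤suc-layerCount rest∈S) ⟩
      suc (layerCount S b) + l           ≡⟨ +-suc (layerCount S b) l ⟨
      layerCount S b + suc l             ≤⟨ +-monoʳ-≤ (layerCount S b) (twoInComponent⇒l<layerCount
                                              (zeroForcingSet⇒meets zf) (Edge⇒≢ H vy ∘ sym)
                                              (sym (complete C v y (vy ◅ ε))) u∈S y∈S) ⟩
      layerCount S b + layerCount S a    ∎

  lowerBound : ∀ {S} → 2 ≤ n → Connected G → IsZeroForcingSet (lexAdj G H) S → (n ∸ 1) * l + k ≤ ∣ S ∣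
  lowerBound {S} n≥2 conn zf with heavyLayerPair n≥2 conn zf
  ... | b , c , b≢c , heavy = begin
    (n ∸ 1) * l + k                                  ≡⟨ [n∸1]*l+k≡k+l+[n∸2]*l l k n≥2 ⟩
    k + l + (n ∸ 2) * l                              ≤⟨ +-monoˡ-≤ ((n ∸ 2) * l) heavy ⟩
    layerCount S b + layerCount S c + (n ∸ 2) * l    ≤⟨ ∑-≥-allBut₂ (layerCount S) b≢c
                                                          (λ a _ _ → meets⇒l≤layerCount (zeroForcingSet⇒meets zf) a) ⟩
    ∑ (layerCount S)                                 ≡⟨ ∣S∣≡∑layerCount S ⟨
    ∣ S ∣                                            ∎
    where open ≤-Reasoning

mainTheorem3 : ∀ {n k l} (G : Graph n) (H : Graph k) (C : Components H l) →
    2 ≤ n → Connected G → 1 ≤ l → (∀ i → 2 ≤ componentOrder C i) →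
    ∀ (S : Subset (n * k)) → IsZeroForcingSet (lexAdj G H) S →
    (n ∸ 1) * l + sum (map (componentOrder C) (allFin l)) ≤ ∣ S ∣
mainTheorem3 {n} {k} {l} G H C n≥2 conn _ nontrivial S zf = begin
  (n ∸ 1) * l + sum (map (componentOrder C) (allFin l))   ≡⟨ cong ((n ∸ 1) * l +_) (∑componentOrder≡order C) ⟩
  (n ∸ 1) * l + k                                         ≤⟨ ZeroForcing.lowerBound G H C nontrivial n≥2 conn zf ⟩
  ∣ S ∣                                                   ∎
  where open ≤-Reasoning
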